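{- A template $T$ is 2-Helly if and only if no instance over $T$ admits a $(k,k+1)$-anomaly for any $k\ge 2$.
   Context: A template $T$ is a finite relational structure: a finite carrier set with a finite family of relations $R\subseteq T^n$ of specified arities. An instance $I$ over $T$ is a finite set with a finite set of constraints $R(a_1,\dots,a_n)$ ($R$ an $n$-ary template relation, $a_i\in I$). A partial function $h:I\rightharpoonup T$ is a partial solution if $(h(a_1),\dots,h(a_n))\in R$ for every constraint $R(a_1,\dots,a_n)$ with all $a_i\in\mathrm{dom}(h)$; a solution is a total partial solution; the size of $h$ is $|\mathrm{dom}(h)|$. For $k<j$, a $(k,j)$-anomaly of $I$ is a partial solution $h$ of size $j$ that does not extend to a solution of $I$, but whose restriction to every $k$-element subset of $\mathrm{dom}(h)$ extends to a solution of $I$. $T$ is 2-Helly if no instance over $T$ admits a $(2,j)$-anomaly for any $j>2$. -}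

module Defs where

open import Data.Nat using (ℕ; _<_)
open import Data.Fin using (Fin)
open import Data.Fin.Subset using (Subset; _⊆_; ∣_∣; _∈_)
open import Data.Vec using (Vec; map; lookup; tabulate)
open import Data.List using (List)
import Data.List.Membership.Propositional as LM
open import Data.Maybe using (Maybe; just; nothing; is-just)
open import Data.Bool using (if_then_else_)
open import Data.Product using (Σ; ∃; _×_)
open import Relation.Nullary using (¬_)
open import Relation.Binary.PropositionalEquality using (_≡_)

record Template : Set where
  field
    size  : ℕ
    nrels : ℕ
    arity : Fin nrels → ℕ
    rel   : (i : Fin nrels) → List (Vec (Fin size) (arity i))
open Template public

record Instance (T : Template) : Set where
  field
    isize       : ℕ
    constraints : List (Σ (Fin (nrels T)) λ i → Vec (Fin isize) (arity T i))
open Instance public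

module _ {T : Template} (I : Instance T) where

  Elem : Set
  Elem = Fin (isize I)

  Val : Set
  Val = Fin (size T)

  PFun : Set
  PFun = Elem → Maybe Val

  dom : PFun → Subset (isize I)
  dom h = tabulate λ a → is-just (h a)

  sizeOf : PFun → ℕ
  sizeOf h = ∣ dom h ∣

  -- every constraint whose scope lies in dom(h) is mapped into its relation
  IsPartialSolution : PFun → Set
  IsPartialSolution h =
    ∀ {i} {as : Vec Elem (arity T i)} → (i Data.Product., as) LM.∈ constraints I →
    ∀ (v : Vec Val (arity T i)) → map h as ≡ map just v → v LM.∈ rel T i

  IsSolution : (Elem → Val) → Set
  IsSolution s =
    ∀ {i} {as : Vec Elem (arity T i)} → (i Data.Product., as) LM.∈ constraints I →
    map s as LM.∈ rel T i

  Extends : (Elem → Val) → PFun → Set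
  Extends s h = ∀ a x → h a ≡ just x → s a ≡ x

  ExtendsToSolution : PFun → Set
  ExtendsToSolution h = ∃ λ s → IsSolution s × Extends s h

  restrict : PFun → Subset (isize I) → PFun
  restrict h S a = if lookup S a then h a else nothing

  IsAnomaly : ℕ → ℕ → PFun → Set
  IsAnomaly k j h =
    k < j × IsPartialSolution h × sizeOf h ≡ j × ¬ ExtendsToSolution h ×
    (∀ (S : Subset (isize I)) → S ⊆ dom h → ∣ S ∣ ≡ k → ExtendsToSolution (restrict h S))

  HasAnomaly : ℕ → ℕ → Set
  HasAnomaly k j = ∃ λ h → IsAnomaly k j h

TwoHelly : Template → Set
TwoHelly T = ∀ (I : Instance T) (j : ℕ) → 2 < j → ¬ HasAnomaly I 2 j

-- A (k, k+1)-anomaly is already a (2, k+1)-anomaly, since every 2-subset of its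
-- domain lies in a k-subset. Conversely, let h be a (2, j)-anomaly. Going up from
-- m = 2, if every m-subset of dom h gives an extendable restriction but some
-- (m+1)-subset S does not, then h restricted to S is an (m, m+1)-anomaly. So every
-- restriction of h extends, in particular h itself, a contradiction. Since the
-- goal is a negation, the case split on extendability is done under a double
-- negation, which commutes with the (finite) quantifier over subsets.
module Submission where

open import Defs
open import Data.Nat using (ℕ; zero; suc; _≤_; _≤′_; ≤′-refl; ≤′-step; s≤s; z≤n; _≤?_)
open import Data.Nat.Properties using (≤-trans; ≤-pred; ≰⇒>; <⇒≤; n≤1+n; n<1+n; ≤⇒≤′; ≤′⇒≤)
open import Data.Fin.Subset using (Subset; _⊆_; _∈_; ∣_∣; inside; outside)
open import Data.Fin.Subset.Properties using (drop-∷-⊆; s⊆s; out⊆; p⊆q⇒∣p∣≤∣q∣; ⊆-refl)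
open import Data.Vec using (Vec; []; _∷_; map; lookup; here)
open import Data.Vec.Properties using (∷-injective; []=⇒lookup; lookup⇒[]=; lookup∘tabulate; tabulate∘lookup; tabulate-cong)
open import Data.Maybe using (just; is-just)
open import Data.Bool using (true; false)
open import Data.Product using (∃; _×_; _,_; proj₁; proj₂)
open import Data.Empty using (⊥-elim)
open import Relation.Nullary using (¬_; yes; no)
open import Relation.Binary.PropositionalEquality using (_≡_; refl; sym; trans; cong; cong₂; subst)

¬¬-∀-Subset : ∀ n {P : Subset n → Set} → (∀ S → ¬ ¬ P S) → ¬ ¬ (∀ S → P S)
¬¬-∀-Subset zero       ¬¬P ¬∀P = ¬¬P [] (λ P[] → ¬∀P λ { [] → P[] })
¬¬-∀-Subset (suc n) {P} ¬¬P ¬∀P =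
  ¬¬-∀-Subset n {λ S → P (inside ∷ S)} (λ S → ¬¬P (inside ∷ S)) λ P-in →
  ¬¬-∀-Subset n {λ S → P (outside ∷ S)} (λ S → ¬¬P (outside ∷ S)) λ P-out →
  ¬∀P λ { (inside ∷ S) → P-in S ; (outside ∷ S) → P-out S }

⊆-interpolate : ∀ {n} k {S D : Subset n} → S ⊆ D → ∣ S ∣ ≤ k → k ≤ ∣ D ∣ →
                ∃ λ S′ → S ⊆ S′ × S′ ⊆ D × ∣ S′ ∣ ≡ k
⊆-interpolate k {[]} {[]} _ z≤n z≤n = [] , ⊆-refl , ⊆-refl , refl
⊆-interpolate k {inside ∷ S} {outside ∷ D} S⊆D _ _ with S⊆D here
... | ()
⊆-interpolate (suc k) {inside ∷ S} {inside ∷ D} S⊆D (s≤s ∣S∣≤k) (s≤s k≤∣D∣)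
  with S′ , S⊆S′ , S′⊆D , ∣S′∣≡k ← ⊆-interpolate k (drop-∷-⊆ S⊆D) ∣S∣≤k k≤∣D∣
  = inside ∷ S′ , s⊆s S⊆S′ , s⊆s S′⊆D , cong suc ∣S′∣≡k
⊆-interpolate k {outside ∷ S} {outside ∷ D} S⊆D ∣S∣≤k k≤∣D∣
  with S′ , S⊆S′ , S′⊆D , ∣S′∣≡k ← ⊆-interpolate k (drop-∷-⊆ S⊆D) ∣S∣≤k k≤∣D∣
  = outside ∷ S′ , s⊆s S⊆S′ , s⊆s S′⊆D , ∣S′∣≡k
⊆-interpolate k {outside ∷ S} {inside ∷ D} S⊆D ∣S∣≤k k≤1+∣D∣ with k ≤? ∣ D ∣
... | yes k≤∣D∣
  with S′ , S⊆S′ , S′⊆D , ∣S′∣≡k ← ⊆-interpolate k (drop-∷-⊆ S⊆D) ∣S∣≤k k≤∣D∣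
  = outside ∷ S′ , s⊆s S⊆S′ , out⊆ S′⊆D , ∣S′∣≡k
... | no k≰∣D∣ with k | k≤1+∣D∣
...   | zero  | _ = ⊥-elim (k≰∣D∣ z≤n)
...   | suc k | s≤s k≤∣D∣
  with S′ , S⊆S′ , S′⊆D , ∣S′∣≡k ←
         ⊆-interpolate k (drop-∷-⊆ S⊆D) (≤-trans (p⊆q⇒∣p∣≤∣q∣ (drop-∷-⊆ S⊆D)) (≤-pred (≰⇒> k≰∣D∣))) k≤∣D∣
  = inside ∷ S′ , out⊆ S⊆S′ , s⊆s S′⊆D , cong suc ∣S′∣≡k

module _ {T : Template} (I : Instance T) where

  infix 4 _⊑_
  _⊑_ : PFun I → PFun I → Set
  g ⊑ h = ∀ a x → g a ≡ just x → h a ≡ just x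

  extendsToSolution-antitone : ∀ {g h} → g ⊑ h → ExtendsToSolution I h → ExtendsToSolution I g
  extendsToSolution-antitone g⊑h (s , sol , s⊒h) = s , sol , λ a x ga≡x → s⊒h a x (g⊑h a x ga≡x)

  isPartialSolution-antitone : ∀ {g h} → g ⊑ h → IsPartialSolution I h → IsPartialSolution I g
  isPartialSolution-antitone {g} {h} g⊑h ps {as = as} c∈I v gas≡v = ps c∈I v (map-⊑ as v gas≡v)
    where
    map-⊑ : ∀ {n} (as : Vec (Elem I) n) v → map g as ≡ map just v → map h as ≡ map just v
    map-⊑ []       []      _  = refl
    map-⊑ (a ∷ as) (x ∷ v) eq = cong₂ _∷_ (g⊑h a x (proj₁ eq′)) (map-⊑ as v (proj₂ eq′))
      where eq′ = ∷-injective eq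

  restrict-⊑ : ∀ h S → restrict I h S ⊑ h
  restrict-⊑ h S a x eq with lookup S a
  ... | true = eq

  restrict-monotone : ∀ h {S S′} → S ⊆ S′ → restrict I h S ⊑ restrict I h S′
  restrict-monotone h {S} {S′} S⊆S′ a x eq with lookup S a in a∈S
  ... | true rewrite []=⇒lookup (S⊆S′ (lookup⇒[]= a S a∈S)) = eq

  restrict-restrict-⊑ : ∀ h S S′ → restrict I (restrict I h S) S′ ⊑ restrict I h S′
  restrict-restrict-⊑ h S S′ a x eq with lookup S′ a
  ... | true = restrict-⊑ h S a x eq

  ⊑-restrict-dom : ∀ h → h ⊑ restrict I h (dom I h)
  ⊑-restrict-dom h a x eq rewrite lookup∘tabulate (λ b → is-just (h b)) a | eq = refl

  ∈-dom⇒is-just : ∀ h {a} → a ∈ dom I h → is-just (h a) ≡ true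
  ∈-dom⇒is-just h {a} a∈dom = trans (sym (lookup∘tabulate (λ b → is-just (h b)) a)) ([]=⇒lookup a∈dom)

  is-just⇒∈-dom : ∀ h {a} → is-just (h a) ≡ true → a ∈ dom I h
  is-just⇒∈-dom h {a} eq = lookup⇒[]= a (dom I h) (trans (lookup∘tabulate (λ b → is-just (h b)) a) eq)

  dom-restrict : ∀ h {S} → S ⊆ dom I h → dom I (restrict I h S) ≡ S
  dom-restrict h {S} S⊆dom = trans (tabulate-cong pointwise) (tabulate∘lookup S)
    where
    pointwise : ∀ a → is-just (restrict I h S a) ≡ lookup S a
    pointwise a with lookup S a in a∈S
    ... | false = refl
    ... | true with h a | ∈-dom⇒is-just h (S⊆dom (lookup⇒[]= a S a∈S))
    ...   | just _ | _ = refl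

  dom-restrict-⊆ : ∀ h S → dom I (restrict I h S) ⊆ dom I h
  dom-restrict-⊆ h S {a} a∈dom with restrict I h S a in eq | ∈-dom⇒is-just (restrict I h S) a∈dom
  ... | just x | _ = is-just⇒∈-dom h (cong is-just (restrict-⊑ h S a x eq))

  RestrictionExtends : ℕ → PFun I → Subset (isize I) → Set
  RestrictionExtends k h S = S ⊆ dom I h → ∣ S ∣ ≡ k → ExtendsToSolution I (restrict I h S)

  RestrictionsExtend : ℕ → PFun I → Set
  RestrictionsExtend k h = ∀ S → RestrictionExtends k h S

  restrictionsExtend-downward : ∀ {k m h} → k ≤ m → m ≤ sizeOf I h →
    RestrictionsExtend m h → RestrictionsExtend k h
  restrictionsExtend-downward {k} {m} {h} k≤m m≤∣h∣ ext S S⊆dom ∣S∣≡k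
    with S′ , S⊆S′ , S′⊆dom , ∣S′∣≡m ← ⊆-interpolate m S⊆dom (subst (_≤ m) (sym ∣S∣≡k) k≤m) m≤∣h∣
    = extendsToSolution-antitone (restrict-monotone h S⊆S′) (ext S′ S′⊆dom ∣S′∣≡m)

  restrictionsExtend-restrict : ∀ {k} h S →
    RestrictionsExtend k h → RestrictionsExtend k (restrict I h S)
  restrictionsExtend-restrict h S ext S′ S′⊆dom ∣S′∣≡k =
    extendsToSolution-antitone (restrict-restrict-⊑ h S S′)
      (ext S′ (λ a∈S′ → dom-restrict-⊆ h S (S′⊆dom a∈S′)) ∣S′∣≡k)

  restrictionsExtend-size⇒extends : ∀ h → RestrictionsExtend (sizeOf I h) h → ExtendsToSolution I h
  restrictionsExtend-size⇒extends h ext =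
    extendsToSolution-antitone (⊑-restrict-dom h) (ext (dom I h) ⊆-refl refl)

  restrict-anomaly : ∀ {m h S} → IsPartialSolution I h → RestrictionsExtend m h →
    S ⊆ dom I h → ∣ S ∣ ≡ suc m → ¬ ExtendsToSolution I (restrict I h S) →
    IsAnomaly I m (suc m) (restrict I h S)
  restrict-anomaly {m} {h} {S} ps ext S⊆dom ∣S∣≡1+m ¬ext =
    n<1+n m ,
    isPartialSolution-antitone (restrict-⊑ h S) ps ,
    trans (cong ∣_∣ (dom-restrict h S⊆dom)) ∣S∣≡1+m ,
    ¬ext ,
    restrictionsExtend-restrict h S ext

  restrictionsExtend-step : ∀ {m h} → ¬ HasAnomaly I m (suc m) → IsPartialSolution I h →
    RestrictionsExtend m h → ¬ ¬ RestrictionsExtend (suc m) h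
  restrictionsExtend-step {m} {h} ¬anomaly ps ext =
    ¬¬-∀-Subset (isize I) {RestrictionExtends (suc m) h} λ S ¬extS →
    ¬extS λ S⊆dom ∣S∣≡1+m →
    ⊥-elim (¬anomaly (restrict I h S ,
      restrict-anomaly ps ext S⊆dom ∣S∣≡1+m λ extS → ¬extS λ _ _ → extS))

NoSmallAnomalies : Template → Set
NoSmallAnomalies T = ∀ (k : ℕ) → 2 ≤ k → ∀ (I : Instance T) → ¬ HasAnomaly I k (suc k)

twoHelly⇒noSmallAnomalies : ∀ {T} → TwoHelly T → NoSmallAnomalies T
twoHelly⇒noSmallAnomalies helly k 2≤k I (h , _ , ps , ∣h∣≡1+k , ¬ext , ext) =
  helly I (suc k) (s≤s 2≤k) (h , s≤s 2≤k , ps , ∣h∣≡1+k , ¬ext ,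
    restrictionsExtend-downward I 2≤k (subst (k ≤_) (sym ∣h∣≡1+k) (n≤1+n k)) ext)

noSmallAnomalies⇒twoHelly : ∀ {T} → NoSmallAnomalies T → TwoHelly T
noSmallAnomalies⇒twoHelly none I j 2<j (h , _ , ps , ∣h∣≡j , ¬ext , ext₂) =
  ¬¬restrictionsExtend (≤⇒≤′ (subst (2 ≤_) (sym ∣h∣≡j) (<⇒≤ 2<j)))
    (λ ext → ¬ext (restrictionsExtend-size⇒extends I h ext))
  where
  ¬¬restrictionsExtend : ∀ {m} → 2 ≤′ m → ¬ ¬ RestrictionsExtend I m h
  ¬¬restrictionsExtend ≤′-refl ¬extₘ = ¬extₘ ext₂
  ¬¬restrictionsExtend (≤′-step 2≤′m) ¬extₘ₊₁ = ¬¬restrictionsExtend 2≤′m λ extₘ →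
    restrictionsExtend-step I (none _ (≤′⇒≤ 2≤′m) I) ps extₘ ¬extₘ₊₁

lemma1 : (T : Template) →
    (TwoHelly T → ∀ (k : ℕ) → 2 ≤ k → ∀ (I : Instance T) → ¬ HasAnomaly I k (suc k)) ×
    ((∀ (k : ℕ) → 2 ≤ k → ∀ (I : Instance T) → ¬ HasAnomaly I k (suc k)) → TwoHelly T)
lemma1 T = twoHelly⇒noSmallAnomalies , noSmallAnomalies⇒twoHelly
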